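{- Let $\mathcal V$ be a type universe. The following are equivalent: (i) one can give a positive locally small $\delta_{\mathcal V}$-complete poset with $\neg\neg$-stable equality; (ii) one can give a positive locally small $\delta_{\mathcal V}$-complete poset with decidable equality; (iii) excluded middle in $\mathcal V$ holds, i.e. $P+\neg P$ for every proposition $P:\mathcal V$.
   Context: Setting: intensional Martin-Löf type theory (univalent foundations) with non-cumulative type universes, function extensionality, propositional extensionality and propositional truncations; excluded middle, choice and resizing are not assumed. A proposition is a type any two of whose elements are equal; a type is $\mathcal V$-small if equivalent to a type in $\mathcal V$. A poset is a type $X$ with a proposition-valued reflexive, transitive, antisymmetric relation $\sqsubseteq$. It is $\delta_{\mathcal V}$-complete if for all $x\sqsubseteq y$ and every proposition $P:\mathcal V$, the family $\delta_{x,y,P}:\mathbf 1+P\to X$ ($\mathrm{inl}(\star)\mapsto x$, $\mathrm{inr}(p)\mapsto y$) has a least upper bound $\bigvee\delta_{x,y,P}$. In such a poset, $x$ is strictly below $y$ if $x\sqsubseteq y$ and for every $z\sqsupseteq y$ and every proposition $P:\mathcal V$, $z=\bigvee\delta_{x,z,P}$ implies $P$; the poset is positive if it comes with specified $x,y$ with $x$ strictly below $y$. It is locally small if each $x\sqsubseteq y$ is $\mathcal V$-small. Equality on $X$ is decidable if $(x=y)+\neg(x=y)$ for all $x,y$, and $\neg\neg$-stable if $\neg\neg(x=y)\to x=y$ for all $x,y$. -}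

module Defs where

open import Level using (Level; _⊔_) renaming (suc to lsuc)
open import Data.Product using (Σ; _×_; _,_; proj₁)
open import Data.Sum using (_⊎_; inj₁; inj₂)
open import Data.Unit.Polymorphic using (⊤)
open import Relation.Nullary using (¬_; Dec)
open import Relation.Binary.PropositionalEquality using (_≡_)
open import Function.Bundles using (_↔_)

isProp : ∀ {ℓ} → Set ℓ → Set ℓ
isProp A = (a b : A) → a ≡ b

PropExt : (ℓ : Level) → Set (lsuc ℓ)
PropExt ℓ = {P Q : Set ℓ} → isProp P → isProp Q → (P → Q) → (Q → P) → P ≡ Q

EM : (v : Level) → Set (lsuc v)
EM v = (P : Set v) → isProp P → P ⊎ ¬ P

record Poset (u t : Level) : Set (lsuc (u ⊔ t)) where
  field
    Carrier  : Set u
    _⊑_      : Carrier → Carrier → Set t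
    ⊑-prop   : (x y : Carrier) → isProp (x ⊑ y)
    ⊑-refl   : (x : Carrier) → x ⊑ x
    ⊑-trans  : (x y z : Carrier) → x ⊑ y → y ⊑ z → x ⊑ z
    ⊑-antisym : (x y : Carrier) → x ⊑ y → y ⊑ x → x ≡ y

module _ {u t : Level} (X : Poset u t) where
  open Poset X

  IsSup : ∀ {i} {I : Set i} → (I → Carrier) → Carrier → Set (u ⊔ t ⊔ i)
  IsSup {I = I} α s = ((k : I) → α k ⊑ s)
                    × ((b : Carrier) → ((k : I) → α k ⊑ b) → s ⊑ b)

  δ : ∀ {v} (x y : Carrier) (P : Set v) → ⊤ {v} ⊎ P → Carrier
  δ x y P (inj₁ _) = x
  δ x y P (inj₂ _) = y

  δComplete : (v : Level) → Set (u ⊔ t ⊔ lsuc v)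
  δComplete v = (x y : Carrier) → x ⊑ y → (P : Set v) → isProp P
              → Σ Carrier (IsSup (δ x y P))

  module _ {v : Level} (c : δComplete v) where
    ⋁δ : (x y : Carrier) → x ⊑ y → (P : Set v) → isProp P → Carrier
    ⋁δ x y l P p = proj₁ (c x y l P p)

    StrictlyBelow : (x y : Carrier) → Set (u ⊔ t ⊔ lsuc v)
    StrictlyBelow x y = Σ (x ⊑ y) λ x⊑y →
      (z : Carrier) (y⊑z : y ⊑ z) (P : Set v) (pP : isProp P)
      → z ≡ ⋁δ x z (⊑-trans x y z x⊑y y⊑z) P pP → P

    Positive : Set (u ⊔ t ⊔ lsuc v)
    Positive = Σ Carrier λ x → Σ Carrier λ y → StrictlyBelow x y

  LocallySmall : (v : Level) → Set (u ⊔ t ⊔ lsuc v)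
  LocallySmall v = (x y : Carrier) → Σ (Set v) λ A → A ↔ (x ⊑ y)

  DecidableEq : Set u
  DecidableEq = (x y : Carrier) → Dec (x ≡ y)

  ¬¬StableEq : Set u
  ¬¬StableEq = (x y : Carrier) → ¬ ¬ (x ≡ y) → x ≡ y

PosLSδPoset : (v u t : Level) → ((X : Poset u t) → Set u)
            → Set (lsuc (u ⊔ t ⊔ v))
PosLSδPoset v u t E =
  Σ (Poset u t) λ X → Σ (δComplete X v) λ c →
    Positive X c × LocallySmall X v × E X

-- Positivity turns ¬¬-stable equality into double-negation elimination for
-- propositions in 𝓥: if x is strictly below y and ¬¬P, then ⋁δ_{x,y,P} is
-- ¬¬-equal, hence equal, to y, and strictness yields P. Applied to P + ¬P this
-- is excluded middle. Conversely, with excluded middle every poset is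
-- δ_𝓥-complete (⋁δ_{x,y,P} is y or x according as P holds), and the two-element
-- poset false ⊑ true is positive, locally small and has decidable equality.
module Submission where

open import Defs
open import Level using (Level; Lift; lift; lower; 0ℓ)
open import Data.Bool using (Bool; true; false; _≤_; f≤t)
open import Data.Bool.Properties as Bool using (_≟_; ≤-irrelevant)
open import Data.Product using (Σ; _×_; _,_; proj₂)
open import Data.Sum using (_⊎_; inj₁; inj₂)
open import Data.Unit.Polymorphic using (tt)
open import Function using (_∘_)
open import Function.Bundles using (_⇔_; mk⇔; mk↔ₛ′)
open import Relation.Nullary using (¬_; contradiction)
open import Relation.Nullary.Decidable using (map′; decidable-stable)
open import Relation.Nullary.Negation using (¬¬-map)
open import Relation.Binary.PropositionalEquality using (_≡_; refl; sym; trans; cong; subst)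
open import Axiom.Extensionality.Propositional using (Extensionality)

DNE : (v : Level) → Set (Level.suc v)
DNE v = (P : Set v) → isProp P → ¬ ¬ P → P

isProp-⊎-¬ : ∀ {v} {P : Set v} → Extensionality v 0ℓ → isProp P → isProp (P ⊎ ¬ P)
isProp-⊎-¬ _  pP (inj₁ p) (inj₁ q) = cong inj₁ (pP p q)
isProp-⊎-¬ _  _  (inj₁ p) (inj₂ ¬q) = contradiction p ¬q
isProp-⊎-¬ _  _  (inj₂ ¬p) (inj₁ q) = contradiction q ¬p
isProp-⊎-¬ fe _  (inj₂ ¬p) (inj₂ ¬q) = cong inj₂ (fe λ p → contradiction p ¬p)

DNE⇒EM : ∀ {v} → Extensionality v 0ℓ → DNE v → EM v
DNE⇒EM fe dne P pP = dne (P ⊎ ¬ P) (isProp-⊎-¬ fe pP) λ k → k (inj₂ (k ∘ inj₁))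

module _ {u t : Level} (X : Poset u t) where
  open Poset X

  IsSup-unique : ∀ {i} {I : Set i} {α : I → Carrier} {s s′ : Carrier}
               → IsSup X α s → IsSup X α s′ → s ≡ s′
  IsSup-unique (ub , least) (ub′ , least′) =
    ⊑-antisym _ _ (least _ ub′) (least′ _ ub)

  module _ {v : Level} {x y : Carrier} {P : Set v} where

    IsSup-δ-true : x ⊑ y → P → IsSup X (δ X x y P) y
    IsSup-δ-true x⊑y p = (λ { (inj₁ _) → x⊑y ; (inj₂ _) → ⊑-refl y })
                       , λ b ub → ub (inj₂ p)

    IsSup-δ-false : ¬ P → IsSup X (δ X x y P) x
    IsSup-δ-false ¬p = (λ { (inj₁ _) → ⊑-refl x ; (inj₂ p) → contradiction p ¬p })
                     , λ b ub → ub (inj₁ tt)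

    sup-δ-decided : x ⊑ y → P ⊎ ¬ P → Σ Carrier (IsSup X (δ X x y P))
    sup-δ-decided x⊑y (inj₁ p)  = y , IsSup-δ-true x⊑y p
    sup-δ-decided x⊑y (inj₂ ¬p) = x , IsSup-δ-false ¬p

  EM⇒δComplete : ∀ {v} → EM v → δComplete X v
  EM⇒δComplete em x y x⊑y P pP = sup-δ-decided x⊑y (em P pP)

  module _ {v : Level} (c : δComplete X v) where

    ⋁δ-true : ∀ {x y} (x⊑y : x ⊑ y) {P : Set v} (pP : isProp P)
            → P → ⋁δ X c x y x⊑y P pP ≡ y
    ⋁δ-true x⊑y {P} pP p = IsSup-unique (proj₂ (c _ _ x⊑y P pP)) (IsSup-δ-true x⊑y p)

    ⋁δ-false : ∀ {x y} (x⊑y : x ⊑ y) {P : Set v} (pP : isProp P)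
             → ¬ P → ⋁δ X c x y x⊑y P pP ≡ x
    ⋁δ-false x⊑y {P} pP ¬p = IsSup-unique (proj₂ (c _ _ x⊑y P pP)) (IsSup-δ-false ¬p)

    StrictlyBelow⇒DNE : ¬¬StableEq X → ∀ {x y} → StrictlyBelow X c x y → DNE v
    StrictlyBelow⇒DNE stable {x} {y} (x⊑y , strict) P pP ¬¬p =
      strict y (⊑-refl y) P pP (sym (stable _ _ (¬¬-map (⋁δ-true x⊑y′ pP) ¬¬p)))
      where
        -- the order witness StrictlyBelow uses at z = y, so that ⋁δ matches
        x⊑y′ : x ⊑ y
        x⊑y′ = ⊑-trans x y y x⊑y (⊑-refl y)

    EM⇒StrictlyBelow : EM v → ∀ {x y} → x ⊑ y → ¬ (y ⊑ x) → StrictlyBelow X c x y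
    EM⇒StrictlyBelow em {x} {y} x⊑y y⋢x = x⊑y , strict
      where
        strict : (z : Carrier) (y⊑z : y ⊑ z) (P : Set v) (pP : isProp P)
               → z ≡ ⋁δ X c x z (⊑-trans x y z x⊑y y⊑z) P pP → P
        strict z y⊑z P pP z≡⋁δ with em P pP
        ... | inj₁ p  = p
        ... | inj₂ ¬p = contradiction (subst (y ⊑_) z≡x y⊑z) y⋢x
          where
            z≡x : z ≡ x
            z≡x = trans z≡⋁δ (⋁δ-false (⊑-trans x y z x⊑y y⊑z) pP ¬p)

module _ {u t : Level} where

  𝟚 : Poset u t
  𝟚 = record
    { Carrier   = Lift u Bool
    ; _⊑_       = λ a b → Lift t (lower a ≤ lower b)
    ; ⊑-prop    = λ { _ _ (lift p) (lift q) → cong lift (≤-irrelevant p q) }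
    ; ⊑-refl    = λ _ → lift Bool.≤-refl
    ; ⊑-trans   = λ { _ _ _ (lift p) (lift q) → lift (Bool.≤-trans p q) }
    ; ⊑-antisym = λ { _ _ (lift p) (lift q) → cong lift (Bool.≤-antisym p q) }
    }

  𝟚-locallySmall : ∀ {v} → LocallySmall 𝟚 v
  𝟚-locallySmall a b = Lift _ (lower a ≤ lower b)
                     , mk↔ₛ′ (lift ∘ lower) (lift ∘ lower) (λ _ → refl) (λ _ → refl)

  𝟚-decidableEq : DecidableEq 𝟚
  𝟚-decidableEq a b = map′ (cong lift) (cong lower) (lower a ≟ lower b)

  𝟚-positive : ∀ {v} (em : EM v) → Positive 𝟚 (EM⇒δComplete 𝟚 em)
  𝟚-positive em = lift false , lift true
                , EM⇒StrictlyBelow 𝟚 (EM⇒δComplete 𝟚 em) em (lift f≤t) λ { (lift ()) }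

EM⇒DecidablePoset : ∀ {v u t} → EM v → PosLSδPoset v u t DecidableEq
EM⇒DecidablePoset {t = t} em =
  𝟚 , EM⇒δComplete 𝟚 em , 𝟚-positive em , 𝟚-locallySmall , 𝟚-decidableEq {t = t}

¬¬StablePoset⇒EM : ∀ {v u t} → Extensionality v 0ℓ → PosLSδPoset v u t ¬¬StableEq → EM v
¬¬StablePoset⇒EM fe (X , c , (_ , _ , x<y) , _ , stable) =
  DNE⇒EM fe (StrictlyBelow⇒DNE X c stable x<y)

DecidableEq⇒¬¬StableEq : ∀ {u t} (X : Poset u t) → DecidableEq X → ¬¬StableEq X
DecidableEq⇒¬¬StableEq X _≟X_ x y = decidable-stable (x ≟X y)

PosLSδPoset-map : ∀ {v u t} {E E′ : Poset u t → Set u} → (∀ X → E X → E′ X)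
                → PosLSδPoset v u t E → PosLSδPoset v u t E′
PosLSδPoset-map f (X , c , pos , ls , e) = X , c , pos , ls , f X e

mainTheorem3 : (fe : ∀ {a b} → Extensionality a b) (pe : ∀ {ℓ} → PropExt ℓ)
               (v u t : Level)
               → (PosLSδPoset v u t ¬¬StableEq ⇔ EM v)
               × (PosLSδPoset v u t DecidableEq ⇔ EM v)
mainTheorem3 fe _ v u t =
    mk⇔ (¬¬StablePoset⇒EM fe) (decidable⇒stable ∘ EM⇒DecidablePoset)
  , mk⇔ (¬¬StablePoset⇒EM fe ∘ decidable⇒stable) EM⇒DecidablePoset
  where
    decidable⇒stable : PosLSδPoset v u t DecidableEq → PosLSδPoset v u t ¬¬StableEq
    decidable⇒stable = PosLSδPoset-map DecidableEq⇒¬¬StableEq
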